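{- Let $\mathcal{D}_1\subseteq\mathcal{L}(A)$ and $\mathcal{D}_2\subseteq\mathcal{L}(B)$ be Condorcet domains on disjoint finite sets $A$ and $B$ with $|A|=m$ and $|B|=n$. Then for any $u\in\mathcal{D}_1$ and $v\in\mathcal{D}_2$, $$|(\mathcal{D}_1\otimes\mathcal{D}_2)(u,v)|=|\mathcal{D}_1|\,|\mathcal{D}_2|+\binom{n+m}{m}-1.$$
   Context: $\mathcal{L}(X)$ denotes the set of strict linear orders on a finite set $X$, written as strings ($a_1a_2\dots a_n$ means $a_1>\dots>a_n$). A Condorcet domain is a set $\mathcal{D}\subseteq\mathcal{L}(X)$ such that for every finite sequence of an odd number of orders from $\mathcal{D}$, the majority relation ($a$ above $b$ iff more orders rank $a$ above $b$ than $b$ above $a$) is transitive. For disjoint $A,B$: $\mathcal{D}_1\odot\mathcal{D}_2=\{xy : x\in\mathcal{D}_1,\ y\in\mathcal{D}_2\}$, where $xy$ ranks all of $A$ above all of $B$, following $x$ on $A$ and $y$ on $B$; for $u\in\mathcal{L}(A)$, $v\in\mathcal{L}(B)$, $u\oplus v$ is the set of all $w\in\mathcal{L}(A\cup B)$ whose restriction to $A$ is $u$ and whose restriction to $B$ is $v$; and $(\mathcal{D}_1\otimes\mathcal{D}_2)(u,v):=(\mathcal{D}_1\odot\mathcal{D}_2)\cup(u\oplus v)$. -}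

module Defs where

open import Data.Nat using (ℕ; zero; suc; _+_; _*_; _<_)
open import Data.Bool using (Bool; true; false; if_then_else_)
open import Data.List using (List; []; _∷_; length; map; filter; _++_; mapMaybe)
open import Data.List.Membership.Propositional using (_∈_)
open import Data.List.Relation.Unary.All using (All)
open import Data.List.Relation.Unary.Unique.Propositional using (Unique)
open import Data.Product using (Σ; ∃; _×_; _,_)
open import Data.Sum using (_⊎_; inj₁; inj₂)
open import Data.Maybe using (Maybe; just; nothing)
open import Relation.Binary.PropositionalEquality using (_≡_)
open import Relation.Binary.Definitions using (DecidableEquality)
open import Relation.Nullary using (does)
open import Function.Bundles using (_⇔_)

-- A strict linear order on a finite type X is written as the list
-- a₁ a₂ … aₖ (meaning a₁ > a₂ > … > aₖ) listing every element of X exactly once.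
IsLinearOrder : {X : Set} → List X → Set
IsLinearOrder {X} xs = Unique xs × (∀ (x : X) → x ∈ xs)

ranks : {X : Set} → DecidableEquality X → List X → X → X → Bool
ranks _≟_ [] a b = false
ranks _≟_ (c ∷ cs) a b =
  if does (c ≟ b) then false
  else (if does (c ≟ a) then occurs cs else ranks _≟_ cs a b)
  where
  occurs : List _ → Bool
  occurs [] = false
  occurs (d ∷ ds) = if does (d ≟ b) then true else occurs ds

count : {X : Set} → DecidableEquality X → List (List X) → X → X → ℕ
count _≟_ P a b = length (filter (λ o → ranks _≟_ o a b Data.Bool.≟ true) P)

Majority : {X : Set} → DecidableEquality X → List (List X) → X → X → Set
Majority _≟_ P a b = count _≟_ P b a < count _≟_ P a b

Odd : ℕ → Set
Odd k = ∃ λ j → k ≡ suc (2 * j)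

IsCondorcetDomain : {X : Set} → DecidableEquality X → List (List X) → Set
IsCondorcetDomain {X} _≟_ D =
  All IsLinearOrder D ×
  (∀ (P : List (List X)) → All (_∈ D) P → Odd (length P) →
     ∀ (a b c : X) → Majority _≟_ P a b → Majority _≟_ P b c → Majority _≟_ P a c)

restrictA : {A B : Set} → List (A ⊎ B) → List A
restrictA = mapMaybe λ { (inj₁ a) → just a ; (inj₂ _) → nothing }

restrictB : {A B : Set} → List (A ⊎ B) → List B
restrictB = mapMaybe λ { (inj₁ _) → nothing ; (inj₂ b) → just b }

concatOrd : {A B : Set} → List A → List B → List (A ⊎ B)
concatOrd x y = map inj₁ x ++ map inj₂ y

In⊙ : {A B : Set} → List (List A) → List (List B) → List (A ⊎ B) → Set
In⊙ D₁ D₂ w = ∃ λ x → ∃ λ y → x ∈ D₁ × y ∈ D₂ × w ≡ concatOrd x y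

In⊕ : {A B : Set} → List A → List B → List (A ⊎ B) → Set
In⊕ u v w = IsLinearOrder w × restrictA w ≡ u × restrictB w ≡ v

In⊗ : {A B : Set} → List (List A) → List (List B) → List A → List B → List (A ⊎ B) → Set
In⊗ D₁ D₂ u v w = In⊙ D₁ D₂ w ⊎ In⊕ u v w

HasCardinality : {Y : Set} → (Y → Set) → ℕ → Set
HasCardinality {Y} S k =
  ∃ λ (L : List Y) → Unique L × (∀ y → (y ∈ L) ⇔ S y) × length L ≡ k

module Submission where

-- Only the linearity of the orders in D₁ and D₂ matters, not the Condorcet
-- property. The set (D₁ ⊗ D₂)(u,v) is the disjoint union of D₁ ⊙ D₂, of size
-- |D₁| |D₂| because concatenation of orders is injective, and of the
-- interleavings of u and v other than the block order u v, which already lies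
-- in D₁ ⊙ D₂. An interleaving is fixed by choosing which m of the n + m
-- positions carry elements of A, so there are C(n + m, m) of them.

open import Defs
open import Data.Nat using (ℕ; suc; _+_; _*_; _∸_; z≤n)
open import Data.Nat.Properties using (+-suc; +-comm; +-identityʳ)
open import Data.Nat.Combinatorics using (_C_; nCn≡1; nCk≡nC[n∸k]; nCk+nC[k+1]≡[n+1]C[k+1])
open import Data.Fin using (Fin)
open import Data.Fin.Properties renaming (_≟_ to _≟F_)
open import Data.List using (List; []; _∷_; length; map; _++_; allFin; cartesianProductWith)
open import Data.List.Properties
  using (length-map; length-++; length-tabulate; ++-identityʳ; ∷-injectiveʳ;
         mapMaybe-++; mapMaybe-map-retract; mapMaybe-map-none)
open import Data.List.Membership.Propositional using (_∈_)
open import Data.List.Membership.Propositional.Properties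
  using (∈-allFin; ∈-map⁺; ∈-map⁻; ∈-++⁺ˡ; ∈-++⁺ʳ; ∈-++⁻;
         ∈-cartesianProductWith⁺; ∈-cartesianProductWith⁻)
open import Data.List.Membership.Propositional.Properties.WithK using (unique∧set⇒bag)
open import Data.List.Relation.Binary.BagAndSetEquality using (∼bag⇒↭)
open import Data.List.Relation.Binary.Permutation.Propositional.Properties using (↭-length)
open import Data.List.Relation.Unary.All as All using (All; [])
open import Data.List.Relation.Unary.AllPairs using ([]; _∷_)
open import Data.List.Relation.Unary.Any using (here; there)
open import Data.List.Relation.Unary.Unique.Propositional using (Unique)
open import Data.List.Relation.Unary.Unique.Propositional.Properties
  using (allFin⁺; ++⁺; map⁺; cartesianProductWith⁺)
open import Data.Product using (_×_; _,_; map₁; map₂)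
open import Data.Sum using (inj₁; inj₂; _⊎_)
open import Data.Empty using (⊥)
open import Function.Bundles using (_⇔_; mk⇔)
open import Relation.Binary.PropositionalEquality
open ≡-Reasoning

linearOrder-length : ∀ {m} {u : List (Fin m)} → IsLinearOrder u → length u ≡ m
linearOrder-length {m} {u} (unique , complete) = begin
  length u           ≡⟨ ↭-length (∼bag⇒↭ (unique∧set⇒bag unique (allFin⁺ m) (mk⇔ (λ _ → ∈-allFin _) (λ _ → complete _)))) ⟩
  length (allFin m)  ≡⟨ length-tabulate _ ⟩
  m                  ∎

length-cartesianProductWith : ∀ {A B C : Set} (f : A → B → C) (xs : List A) (ys : List B) →
  length (cartesianProductWith f xs ys) ≡ length xs * length ys
length-cartesianProductWith f []       ys = refl
length-cartesianProductWith f (x ∷ xs) ys = begin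
  length (map (f x) ys ++ cartesianProductWith f xs ys)
    ≡⟨ length-++ (map (f x) ys) ⟩
  length (map (f x) ys) + length (cartesianProductWith f xs ys)
    ≡⟨ cong₂ _+_ (length-map (f x) ys) (length-cartesianProductWith f xs ys) ⟩
  length ys + length xs * length ys
    ∎

module _ {A B : Set} where

  restrictA-concatOrd : ∀ (xs : List A) (ys : List B) → restrictA (concatOrd xs ys) ≡ xs
  restrictA-concatOrd xs ys = begin
    restrictA (map inj₁ xs ++ map inj₂ ys)           ≡⟨ mapMaybe-++ _ (map inj₁ xs) (map inj₂ ys) ⟩
    restrictA (map inj₁ xs) ++ restrictA (map inj₂ ys) ≡⟨ cong₂ _++_ (mapMaybe-map-retract (λ _ → refl) xs)
                                                                    (mapMaybe-map-none (λ _ → refl) ys) ⟩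
    xs ++ []                                         ≡⟨ ++-identityʳ xs ⟩
    xs                                               ∎

  restrictB-concatOrd : ∀ (xs : List A) (ys : List B) → restrictB (concatOrd xs ys) ≡ ys
  restrictB-concatOrd xs ys = begin
    restrictB (map inj₁ xs ++ map inj₂ ys)           ≡⟨ mapMaybe-++ _ (map inj₁ xs) (map inj₂ ys) ⟩
    restrictB (map inj₁ xs) ++ restrictB (map inj₂ ys) ≡⟨ cong₂ _++_ (mapMaybe-map-none (λ _ → refl) xs)
                                                                    (mapMaybe-map-retract (λ _ → refl) ys) ⟩
    ys                                               ∎

  concatOrd-injective : ∀ {xs xs′ : List A} {ys ys′ : List B} →
    concatOrd xs ys ≡ concatOrd xs′ ys′ → xs ≡ xs′ × ys ≡ ys′
  concatOrd-injective {xs} {xs′} {ys} {ys′} eq =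
    trans (sym (restrictA-concatOrd xs ys)) (trans (cong restrictA eq) (restrictA-concatOrd xs′ ys′)) ,
    trans (sym (restrictB-concatOrd xs ys)) (trans (cong restrictB eq) (restrictB-concatOrd xs′ ys′))

  ∈-restrictA⁺ : ∀ {a} (w : List (A ⊎ B)) → inj₁ a ∈ w → a ∈ restrictA w
  ∈-restrictA⁺ (inj₁ _ ∷ w) (here refl) = here refl
  ∈-restrictA⁺ (inj₁ _ ∷ w) (there p)   = there (∈-restrictA⁺ w p)
  ∈-restrictA⁺ (inj₂ _ ∷ w) (there p)   = ∈-restrictA⁺ w p

  ∈-restrictA⁻ : ∀ {a} (w : List (A ⊎ B)) → a ∈ restrictA w → inj₁ a ∈ w
  ∈-restrictA⁻ (inj₁ _ ∷ w) (here refl) = here refl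
  ∈-restrictA⁻ (inj₁ _ ∷ w) (there p)   = there (∈-restrictA⁻ w p)
  ∈-restrictA⁻ (inj₂ _ ∷ w) p           = there (∈-restrictA⁻ w p)

  ∈-restrictB⁺ : ∀ {b} (w : List (A ⊎ B)) → inj₂ b ∈ w → b ∈ restrictB w
  ∈-restrictB⁺ (inj₂ _ ∷ w) (here refl) = here refl
  ∈-restrictB⁺ (inj₂ _ ∷ w) (there p)   = there (∈-restrictB⁺ w p)
  ∈-restrictB⁺ (inj₁ _ ∷ w) (there p)   = ∈-restrictB⁺ w p

  ∈-restrictB⁻ : ∀ {b} (w : List (A ⊎ B)) → b ∈ restrictB w → inj₂ b ∈ w
  ∈-restrictB⁻ (inj₂ _ ∷ w) (here refl) = here refl
  ∈-restrictB⁻ (inj₂ _ ∷ w) (there p)   = there (∈-restrictB⁻ w p)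
  ∈-restrictB⁻ (inj₁ _ ∷ w) p           = there (∈-restrictB⁻ w p)

  restrictions-unique⇒unique : ∀ (w : List (A ⊎ B)) →
    Unique (restrictA w) → Unique (restrictB w) → Unique w
  restrictions-unique⇒unique []           _          _          = []
  restrictions-unique⇒unique (inj₁ a ∷ w) (a∉ ∷ uA) uB =
    All.tabulate (λ { p refl → All.lookup a∉ (∈-restrictA⁺ w p) refl }) ∷ restrictions-unique⇒unique w uA uB
  restrictions-unique⇒unique (inj₂ b ∷ w) uA (b∉ ∷ uB) =
    All.tabulate (λ { p refl → All.lookup b∉ (∈-restrictB⁺ w p) refl }) ∷ restrictions-unique⇒unique w uA uB

  restrictions-linear⇒linear : ∀ (w : List (A ⊎ B)) →
    IsLinearOrder (restrictA w) → IsLinearOrder (restrictB w) → IsLinearOrder w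
  restrictions-linear⇒linear w (uA , allA) (uB , allB) =
    restrictions-unique⇒unique w uA uB ,
    λ { (inj₁ a) → ∈-restrictA⁻ w (allA a) ; (inj₂ b) → ∈-restrictB⁻ w (allB b) }

  interleavings        : List A → List B → List (List (A ⊎ B))
  properInterleavings  : List A → List B → List (List (A ⊎ B))

  interleavings xs ys = concatOrd xs ys ∷ properInterleavings xs ys

  -- The omitted block order concatOrd (x ∷ xs) (y ∷ ys) = inj₁ x ∷ concatOrd xs (y ∷ ys),
  -- so interleavings (x ∷ xs) (y ∷ ys) reduces to the usual shuffle recursion
  -- map (inj₁ x ∷_) (interleavings xs (y ∷ ys)) ++ map (inj₂ y ∷_) (interleavings (x ∷ xs) ys).
  properInterleavings []       ys       = []
  properInterleavings (x ∷ xs) []       = []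
  properInterleavings (x ∷ xs) (y ∷ ys) =
    map (inj₁ x ∷_) (properInterleavings xs (y ∷ ys)) ++ map (inj₂ y ∷_) (interleavings (x ∷ xs) ys)

  ∈-interleavings⁻ : ∀ (xs : List A) (ys : List B) {w} →
    w ∈ interleavings xs ys → restrictA w ≡ xs × restrictB w ≡ ys
  ∈-interleavings⁻ xs       ys       (here refl) = restrictA-concatOrd xs ys , restrictB-concatOrd xs ys
  ∈-interleavings⁻ (x ∷ xs) (y ∷ ys) (there p)
    with ∈-++⁻ (map (inj₁ x ∷_) (properInterleavings xs (y ∷ ys))) p
  ... | inj₁ q with _ , r , refl ← ∈-map⁻ _ q = map₁ (cong (x ∷_)) (∈-interleavings⁻ xs (y ∷ ys) (there r))
  ... | inj₂ q with _ , r , refl ← ∈-map⁻ _ q = map₂ (cong (y ∷_)) (∈-interleavings⁻ (x ∷ xs) ys r)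

  inj₁∷-∈-interleavings : ∀ a (xs : List A) (ys : List B) {w} →
    w ∈ interleavings xs ys → inj₁ a ∷ w ∈ interleavings (a ∷ xs) ys
  inj₁∷-∈-interleavings a xs       []       (here refl) = here refl
  inj₁∷-∈-interleavings a []       []       (there ())
  inj₁∷-∈-interleavings a (_ ∷ _)  []       (there ())
  inj₁∷-∈-interleavings a xs       (y ∷ ys) p           = ∈-++⁺ˡ (∈-map⁺ (inj₁ a ∷_) p)

  inj₂∷-∈-interleavings : ∀ b (xs : List A) (ys : List B) {w} →
    w ∈ interleavings xs ys → inj₂ b ∷ w ∈ interleavings xs (b ∷ ys)
  inj₂∷-∈-interleavings b []       ys (here refl) = here refl
  inj₂∷-∈-interleavings b (x ∷ xs) ys p           =
    ∈-++⁺ʳ (map (inj₁ x ∷_) (interleavings xs (b ∷ ys))) (∈-map⁺ (inj₂ b ∷_) p)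

  ∈-interleavings-restrictions : ∀ (w : List (A ⊎ B)) → w ∈ interleavings (restrictA w) (restrictB w)
  ∈-interleavings-restrictions []           = here refl
  ∈-interleavings-restrictions (inj₁ a ∷ w) =
    inj₁∷-∈-interleavings a (restrictA w) (restrictB w) (∈-interleavings-restrictions w)
  ∈-interleavings-restrictions (inj₂ b ∷ w) =
    inj₂∷-∈-interleavings b (restrictA w) (restrictB w) (∈-interleavings-restrictions w)

  ∈-interleavings⁺ : ∀ {xs : List A} {ys : List B} {w} →
    restrictA w ≡ xs → restrictB w ≡ ys → w ∈ interleavings xs ys
  ∈-interleavings⁺ {w = w} refl refl = ∈-interleavings-restrictions w

  interleavings-unique : ∀ (xs : List A) (ys : List B) → Unique (interleavings xs ys)
  interleavings-unique []       ys       = [] ∷ []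
  interleavings-unique (x ∷ xs) []       = [] ∷ []
  interleavings-unique (x ∷ xs) (y ∷ ys) =
    ++⁺ (map⁺ ∷-injectiveʳ (interleavings-unique xs (y ∷ ys)))
        (map⁺ ∷-injectiveʳ (interleavings-unique (x ∷ xs) ys))
        heads-differ
    where
    heads-differ : ∀ {w} → w ∈ map (inj₁ x ∷_) (interleavings xs (y ∷ ys)) ×
                           w ∈ map (inj₂ y ∷_) (interleavings (x ∷ xs) ys) → ⊥
    heads-differ (p , q) with _ , _ , refl ← ∈-map⁻ _ p | _ , _ , () ← ∈-map⁻ _ q

  length-interleavings : ∀ (xs : List A) (ys : List B) →
    length (interleavings xs ys) ≡ (length xs + length ys) C length xs
  length-interleavings []       ys = sym (trans (nCk≡nC[n∸k] {0} {length ys} z≤n) (nCn≡1 (length ys)))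
  length-interleavings (x ∷ xs) [] = sym (trans (cong (_C suc (length xs)) (+-identityʳ (suc (length xs))))
                                                (nCn≡1 (suc (length xs))))
  length-interleavings (x ∷ xs) (y ∷ ys) = begin
    length (interleavings (x ∷ xs) (y ∷ ys))
      ≡⟨ length-++ (map (inj₁ x ∷_) (interleavings xs (y ∷ ys))) ⟩
    length (map (inj₁ x ∷_) (interleavings xs (y ∷ ys))) + length (map (inj₂ y ∷_) (interleavings (x ∷ xs) ys))
      ≡⟨ cong₂ _+_ (length-map _ (interleavings xs (y ∷ ys))) (length-map _ (interleavings (x ∷ xs) ys)) ⟩
    length (interleavings xs (y ∷ ys)) + length (interleavings (x ∷ xs) ys)
      ≡⟨ cong₂ _+_ (length-interleavings xs (y ∷ ys)) (length-interleavings (x ∷ xs) ys) ⟩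
    (a + suc b) C a + (suc a + b) C suc a
      ≡⟨ cong (λ k → (a + suc b) C a + k C suc a) (sym (+-suc a b)) ⟩
    (a + suc b) C a + (a + suc b) C suc a
      ≡⟨ nCk+nC[k+1]≡[n+1]C[k+1] (a + suc b) a ⟩
    (suc a + suc b) C suc a
      ∎
    where
    a = length xs
    b = length ys

module _ {A B : Set} (D₁ : List (List A)) (D₂ : List (List B)) (u : List A) (v : List B) where

  ⊗-enumeration : List (List (A ⊎ B))
  ⊗-enumeration = cartesianProductWith concatOrd D₁ D₂ ++ properInterleavings u v

  ∈-⊗-enumeration⇔ : u ∈ D₁ → v ∈ D₂ → IsLinearOrder u → IsLinearOrder v →
    ∀ w → w ∈ ⊗-enumeration ⇔ In⊗ D₁ D₂ u v w
  ∈-⊗-enumeration⇔ u∈D₁ v∈D₂ u-linear v-linear w = mk⇔ to from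
    where
    to : w ∈ ⊗-enumeration → In⊗ D₁ D₂ u v w
    to p with ∈-++⁻ (cartesianProductWith concatOrd D₁ D₂) p
    ... | inj₁ q = inj₁ (∈-cartesianProductWith⁻ concatOrd D₁ D₂ q)
    ... | inj₂ q with restrictA≡u , restrictB≡v ← ∈-interleavings⁻ u v (there q) =
      inj₂ ( restrictions-linear⇒linear w (subst IsLinearOrder (sym restrictA≡u) u-linear)
                                          (subst IsLinearOrder (sym restrictB≡v) v-linear)
           , restrictA≡u , restrictB≡v )

    from : In⊗ D₁ D₂ u v w → w ∈ ⊗-enumeration
    from (inj₁ (x , y , x∈D₁ , y∈D₂ , refl)) = ∈-++⁺ˡ (∈-cartesianProductWith⁺ concatOrd x∈D₁ y∈D₂)
    from (inj₂ (_ , restrictA≡u , restrictB≡v)) with ∈-interleavings⁺ {w = w} restrictA≡u restrictB≡v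
    ... | here refl = ∈-++⁺ˡ (∈-cartesianProductWith⁺ concatOrd u∈D₁ v∈D₂)
    ... | there q   = ∈-++⁺ʳ (cartesianProductWith concatOrd D₁ D₂) q

  ⊗-enumeration-unique : Unique D₁ → Unique D₂ → Unique ⊗-enumeration
  ⊗-enumeration-unique D₁-unique D₂-unique with block∉proper ∷ proper-unique ← interleavings-unique u v =
    ++⁺ (cartesianProductWith⁺ concatOrd concatOrd-injective D₁-unique D₂-unique) proper-unique disjoint
    where
    disjoint : ∀ {w} → w ∈ cartesianProductWith concatOrd D₁ D₂ × w ∈ properInterleavings u v → ⊥
    disjoint (p , q) with x , y , _ , _ , refl ← ∈-cartesianProductWith⁻ concatOrd D₁ D₂ p
                        | x≡u , y≡v ← ∈-interleavings⁻ u v (there q)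
      = All.lookup block∉proper q (sym (cong₂ concatOrd (trans (sym (restrictA-concatOrd x y)) x≡u)
                                                         (trans (sym (restrictB-concatOrd x y)) y≡v)))

  length-⊗-enumeration :
    length ⊗-enumeration ≡ length D₁ * length D₂ + (length u + length v) C length u ∸ 1
  length-⊗-enumeration = begin
    length ⊗-enumeration                   ≡⟨ length-++ (cartesianProductWith concatOrd D₁ D₂) ⟩
    length product + length proper         ≡⟨ cong (_+ length proper) (length-cartesianProductWith concatOrd D₁ D₂) ⟩
    length D₁ * length D₂ + length proper  ≡⟨ sym (cong (_∸ 1) (+-suc (length D₁ * length D₂) (length proper))) ⟩
    length D₁ * length D₂ + length (interleavings u v) ∸ 1
                                           ≡⟨ cong (λ k → length D₁ * length D₂ + k ∸ 1) (length-interleavings u v) ⟩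
    length D₁ * length D₂ + (length u + length v) C length u ∸ 1 ∎
    where
    product = cartesianProductWith concatOrd D₁ D₂
    proper  = properInterleavings u v

proposition3 : (m n : ℕ) (D₁ : List (List (Fin m))) (D₂ : List (List (Fin n))) →
    Unique D₁ → Unique D₂ →
    IsCondorcetDomain _≟F_ D₁ → IsCondorcetDomain _≟F_ D₂ →
    (u : List (Fin m)) (v : List (Fin n)) → u ∈ D₁ → v ∈ D₂ →
    HasCardinality (In⊗ D₁ D₂ u v)
      (length D₁ * length D₂ + (n + m) C m ∸ 1)
proposition3 m n D₁ D₂ D₁-unique D₂-unique (D₁-linear , _) (D₂-linear , _) u v u∈D₁ v∈D₂ =
  ⊗-enumeration D₁ D₂ u v ,
  ⊗-enumeration-unique D₁ D₂ u v D₁-unique D₂-unique ,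
  ∈-⊗-enumeration⇔ D₁ D₂ u v u∈D₁ v∈D₂ u-linear v-linear ,
  (begin
    length (⊗-enumeration D₁ D₂ u v)                              ≡⟨ length-⊗-enumeration D₁ D₂ u v ⟩
    length D₁ * length D₂ + (length u + length v) C length u ∸ 1 ≡⟨ cong (λ k → length D₁ * length D₂ + k ∸ 1)
                                                                        binomial ⟩
    length D₁ * length D₂ + (n + m) C m ∸ 1                        ∎)
  where
  u-linear = All.lookup D₁-linear u∈D₁
  v-linear = All.lookup D₂-linear v∈D₂

  binomial : (length u + length v) C length u ≡ (n + m) C m
  binomial rewrite linearOrder-length u-linear | linearOrder-length v-linear = cong (_C m) (+-comm m n)
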